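{- Let $m\ge2$ and let $\mathcal{B}_R(m)$ be the homogeneous tree of degree $m+1$ whose basin $\mathcal{P}$ is a single edge. Let $v$ be a vertex with $v\notin\mathcal{P}$. Then the number $r(d,v)$ of vertices $x\in\mathcal{R}_{h(v)}$ reachable from $v$ by a path of length $d$ is $$r(d,v)=\begin{cases}0 & d=2k+1,\ k<h(v),\\ m^k & d=2k,\ k<h(v),\\ m^{h(v)} & d\ge 2h(v).\end{cases}$$
   Context: For a tree with basin $\mathcal{P}$: $\mathcal{P}_0=\mathcal{P}$, $\mathcal{P}_n=\{x: d(x,\mathcal{P}_{n-1})\le1\}$, $\mathcal{R}_0=\mathcal{P}$, $\mathcal{R}_n=\mathcal{P}_n\setminus\mathcal{P}_{n-1}$, $h(v)$ the unique $n$ with $v\in\mathcal{R}_n$. Paths are walks, possibly backtracking. -}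

module Defs where

open import Data.Nat using (ℕ; zero; suc)
open import Data.Bool using (Bool; true; false; not)
open import Data.Fin using (Fin)
open import Data.List using (List; []; _∷_; length)
open import Data.List.Relation.Unary.Unique.Propositional using (Unique)
open import Data.List.Membership.Propositional using (_∈_)
open import Data.Product using (Σ; ∃; _×_; _,_)
open import Data.Sum using (_⊎_)
open import Relation.Binary.PropositionalEquality using (_≡_)
open import Relation.Nullary using (¬_)
open import Function.Bundles using (_⇔_)

-- Concrete model of the homogeneous tree of degree m+1 with a distinguished
-- edge (the basin).  The basin edge joins (true , []) and (false , []).
-- A vertex (s , xs) is reached from the basin endpoint (s , []) by moving
-- away from the basin along the branches listed in xs (most recent first);
-- each vertex has m "children" (one per i : Fin m) and one further
-- neighbour (its parent, or the other basin endpoint), so degree m+1.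
Vertex : ℕ → Set
Vertex m = Bool × List (Fin m)

data Adj {m : ℕ} : Vertex m → Vertex m → Set where
  across : ∀ s → Adj (s , []) (not s , [])
  down   : ∀ s (i : Fin m) xs → Adj (s , xs) (s , i ∷ xs)
  up     : ∀ s (i : Fin m) xs → Adj (s , i ∷ xs) (s , xs)

𝒫 : {m : ℕ} → Vertex m → Set
𝒫 x = (x ≡ (true , [])) ⊎ (x ≡ (false , []))

𝒫ₙ : {m : ℕ} → ℕ → Vertex m → Set
𝒫ₙ zero x = 𝒫 x
𝒫ₙ (suc n) x = 𝒫ₙ n x ⊎ (∃ λ y → Adj x y × 𝒫ₙ n y)

ℛ : {m : ℕ} → ℕ → Vertex m → Set
ℛ zero x = 𝒫 x
ℛ (suc n) x = 𝒫ₙ (suc n) x × ¬ 𝒫ₙ n x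

-- walks (backtracking allowed) of length d
data Walk {m : ℕ} : ℕ → Vertex m → Vertex m → Set where
  here : ∀ x → Walk zero x x
  step : ∀ {d x y z} → Adj x y → Walk d y z → Walk (suc d) x z

HasSize : {m : ℕ} → (Vertex m → Set) → ℕ → Set
HasSize {m} S N =
  Σ (List (Vertex m)) λ xs → Unique xs × length xs ≡ N × (∀ x → (x ∈ xs) ⇔ S x)

-- r(d , v) = N  where h(v) = n :  number of x ∈ ℛₙ reachable from v by a walk of length d
rIs : {m : ℕ} → ℕ → (n : ℕ) → Vertex m → ℕ → Set
rIs d n v N = HasSize (λ x → ℛ n x × Walk d v x) N

-- A vertex is a side s of the basin edge together with the word xs of branches leading
-- down to it, so h(v) = |xs| and ℛₙ consists of the words of length n on either side.
-- Flipping the side |xs| times properly 2-colours the tree, so a walk of length d between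
-- two vertices of ℛₙ ends on side notᵈ s.  Crossing the basin edge costs 2n + 1 steps, so
-- a walk of length at most 2k + 1 < 2n + 1 stays below a common ancestor: odd lengths are
-- impossible, and length 2k reaches exactly the m^k vertices of ℛₙ below the k-th ancestor
-- of v.  From length 2n on, every vertex of ℛₙ on side notᵈ s is reached by padding a
-- shortest walk with back-and-forth steps, and there are m^n of them.
module Submission where

open import Defs
open import Data.Nat using (ℕ; zero; suc; _+_; _*_; _^_; _∸_; _≤_; _<_; z≤n; s≤s)
open import Data.Nat.Properties
open import Data.Bool using (Bool; true; false; not)
open import Data.Bool.Properties using (not-involutive; not-injective; not-¬)
open import Data.Fin using (Fin)
open import Data.List using (List; []; _∷_; [_]; _++_; length; drop; take; map; allFin; cartesianProductWith)
open import Data.List.Properties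
  using ( ∷-injective; length-++; length-map; length-tabulate; length-take; length-drop; take++drop≡id
        ; ++-assoc; ++-identityʳ; ++-cancelʳ)
open import Data.List.Relation.Unary.All using ([])
open import Data.List.Relation.Unary.AllPairs using ([]; _∷_)
open import Data.List.Relation.Unary.Any using (here)
open import Data.List.Relation.Unary.Unique.Propositional using (Unique)
open import Data.List.Relation.Unary.Unique.Propositional.Properties using (map⁺; allFin⁺; cartesianProductWith⁺)
open import Data.List.Membership.Propositional using (_∈_)
open import Data.List.Membership.Propositional.Properties
  using (∈-map⁺; ∈-map⁻; ∈-allFin; ∈-cartesianProductWith⁺; ∈-cartesianProductWith⁻)
open import Data.Product using (∃; _×_; _,_; proj₂)
open import Data.Sum using (inj₁; inj₂)
open import Function.Base using (id; _∘_)
open import Function.Bundles using (_⇔_; mk⇔)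
open import Function.Construct.Composition using (_⇔-∘_)
open import Function.Construct.Symmetry using (⇔-sym)
open import Relation.Binary.PropositionalEquality
  using (_≡_; refl; sym; trans; cong; cong₂; subst; subst₂; module ≡-Reasoning)
open import Relation.Nullary using (¬_; contradiction)

private variable
  m n j k d : ℕ
  s t : Bool
  xs ys : List (Fin m)

𝒫ₙ⇒length≤ : ∀ n → 𝒫ₙ n (s , xs) → length xs ≤ n
𝒫ₙ⇒length≤ zero    (inj₁ refl)                 = z≤n
𝒫ₙ⇒length≤ zero    (inj₂ refl)                 = z≤n
𝒫ₙ⇒length≤ (suc n) (inj₁ p)                    = m≤n⇒m≤1+n (𝒫ₙ⇒length≤ n p)
𝒫ₙ⇒length≤ (suc n) (inj₂ (_ , across _ , _))   = z≤n
𝒫ₙ⇒length≤ (suc n) (inj₂ (_ , down _ _ _ , p)) = m<n⇒m≤1+n (𝒫ₙ⇒length≤ n p)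
𝒫ₙ⇒length≤ (suc n) (inj₂ (_ , up _ _ _ , p))   = s≤s (𝒫ₙ⇒length≤ n p)

length≤⇒𝒫ₙ : ∀ n s (xs : List (Fin m)) → length xs ≤ n → 𝒫ₙ n (s , xs)
length≤⇒𝒫ₙ zero    true  []       _       = inj₁ refl
length≤⇒𝒫ₙ zero    false []       _       = inj₂ refl
length≤⇒𝒫ₙ (suc n) s     []       _       = inj₁ (length≤⇒𝒫ₙ n s [] z≤n)
length≤⇒𝒫ₙ (suc n) s     (i ∷ xs) (s≤s l) = inj₂ (_ , up s i xs , length≤⇒𝒫ₙ n s xs l)

ℛ⇒length≡ : ∀ n → ℛ n (s , xs) → length xs ≡ n
ℛ⇒length≡ zero    p       = n≤0⇒n≡0 (𝒫ₙ⇒length≤ zero p)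
ℛ⇒length≡ {s = s} {xs = xs} (suc n) (p , ¬p) =
  ≤-antisym (𝒫ₙ⇒length≤ (suc n) p) (≰⇒> (¬p ∘ length≤⇒𝒫ₙ n s xs))

length≡⇒ℛ : ∀ n s (xs : List (Fin m)) → length xs ≡ n → ℛ n (s , xs)
length≡⇒ℛ zero    s xs e = length≤⇒𝒫ₙ zero s xs (≤-reflexive e)
length≡⇒ℛ (suc n) s xs e =
  length≤⇒𝒫ₙ (suc n) s xs (≤-reflexive e) , λ p → n≮n n (subst (_≤ n) e (𝒫ₙ⇒length≤ n p))

not^ : ℕ → Bool → Bool
not^ zero    b = b
not^ (suc n) b = not (not^ n b)

not^-+ : ∀ a c b → not^ (a + c) b ≡ not^ a (not^ c b)
not^-+ zero    c b = refl
not^-+ (suc a) c b = cong not (not^-+ a c b)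

not^-comm : ∀ a c b → not^ a (not^ c b) ≡ not^ c (not^ a b)
not^-comm a c b = begin
  not^ a (not^ c b) ≡⟨ not^-+ a c b ⟨
  not^ (a + c) b    ≡⟨ cong (λ l → not^ l b) (+-comm a c) ⟩
  not^ (c + a) b    ≡⟨ not^-+ c a b ⟩
  not^ c (not^ a b) ∎
  where open ≡-Reasoning

not^-injective : ∀ n {a b} → not^ n a ≡ not^ n b → a ≡ b
not^-injective zero    e = e
not^-injective (suc n) e = not^-injective n (not-injective e)

not^-even : ∀ k b → not^ (2 * k) b ≡ b
not^-even zero    b = refl
not^-even (suc k) b = trans (cong (λ l → not^ l b) (*-suc 2 k)) (trans (not-involutive _) (not^-even k b))

colour : Vertex m → Bool
colour (s , xs) = not^ (length xs) s

colour-Adj : {x y : Vertex m} → Adj x y → colour y ≡ not (colour x)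
colour-Adj (across _)   = refl
colour-Adj (down _ _ _) = refl
colour-Adj (up _ _ _)   = sym (not-involutive _)

colour-Walk : {x y : Vertex m} → Walk d x y → colour y ≡ not^ d (colour x)
colour-Walk (here _) = refl
colour-Walk {d = suc d} {x = x} (step a w) =
  trans (colour-Walk w) (trans (cong (not^ d) (colour-Adj a)) (not^-comm d 1 (colour x)))

Walk⇒side : Walk d (s , xs) (t , ys) → length xs ≡ length ys → t ≡ not^ d s
Walk⇒side {d = d} {s = s} {xs = xs} {t = t} {ys = ys} w e = not^-injective (length ys) (begin
  not^ (length ys) t          ≡⟨ colour-Walk w ⟩
  not^ d (not^ (length xs) s) ≡⟨ cong (λ l → not^ d (not^ l s)) e ⟩
  not^ d (not^ (length ys) s) ≡⟨ not^-comm d (length ys) s ⟩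
  not^ (length ys) (not^ d s) ∎)
  where open ≡-Reasoning

-- Witnesses that the tree distance is at most d: a walk either stays on one side, passing
-- through a common ancestor (s , zs), or crosses the basin edge.
data Within {m} (d : ℕ) : Vertex m → Vertex m → Set where
  via-ancestor : ∀ {s xs ys} p q zs → xs ≡ p ++ zs → ys ≡ q ++ zs →
                 length p + length q ≤ d → Within d (s , xs) (s , ys)
  via-basin    : ∀ {s t xs ys} → length xs + length ys < d → Within d (s , xs) (t , ys)

Walk⇒Within : {x y : Vertex m} → Walk d x y → Within d x y
Walk⇒Within (here _) = via-ancestor [] [] _ refl refl z≤n
Walk⇒Within (step (across s) w) with Walk⇒Within w
... | via-ancestor []      q _ refl refl q≤d =
  via-basin (s≤s (subst (_≤ _) (sym (cong length (++-identityʳ q))) q≤d))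
... | via-ancestor (_ ∷ _) _ _ () _ _
... | via-basin lt = via-basin (m<n⇒m<1+n lt)
Walk⇒Within (step (down s i xs) w) with Walk⇒Within w
... | via-ancestor [] q _ refl refl q≤d =
  via-ancestor [] (q ++ [ i ]) xs refl (sym (++-assoc q [ i ] xs))
    (≤-trans (≤-reflexive (trans (length-++ q) (+-comm (length q) 1))) (s≤s q≤d))
... | via-ancestor (_ ∷ p) q zs refl refl le = via-ancestor p q zs refl refl (m≤n⇒m≤1+n (<⇒≤ le))
... | via-basin lt = via-basin (m<n⇒m<1+n (<-trans (n<1+n _) lt))
Walk⇒Within (step (up s i xs) w) with Walk⇒Within w
... | via-ancestor p q zs refl refl le = via-ancestor (i ∷ p) q zs refl refl (s≤s le)
... | via-basin lt = via-basin (s≤s lt)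

length-cancelʳ : ∀ {A : Set} (p q zs : List A) → length (p ++ zs) ≡ length (q ++ zs) →
                 length p ≡ length q
length-cancelʳ p q zs e =
  +-cancelʳ-≡ (length zs) (length p) (length q) (trans (sym (length-++ p)) (trans e (length-++ q)))

drop-++-aligned : ∀ {A : Set} k (p q zs : List A) → length p ≡ length q → length p ≤ k →
                  drop k (p ++ zs) ≡ drop k (q ++ zs)
drop-++-aligned k       []      []      _  _ _       = refl
drop-++-aligned k       []      (_ ∷ _) _  () _
drop-++-aligned k       (_ ∷ _) []      _  () _
drop-++-aligned zero    (_ ∷ _) (_ ∷ _) _  _ ()
drop-++-aligned (suc k) (_ ∷ p) (_ ∷ q) zs e (s≤s l) = drop-++-aligned k p q zs (suc-injective e) l

n+n≡2*n : ∀ n → n + n ≡ 2 * n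
n+n≡2*n n = cong (n +_) (sym (+-identityʳ n))

layer-basin-too-far : {A : Set} (xs ys : List A) → length xs ≡ n → length ys ≡ n → k < n →
                      ¬ (length xs + length ys < suc (2 * k))
layer-basin-too-far {n = n} {k = k} xs ys lx ly k<n lt = n≮n (2 * n) (begin-strict
  2 * n                   ≡⟨ n+n≡2*n n ⟨
  n + n                   ≡⟨ cong₂ _+_ lx ly ⟨
  length xs + length ys   ≤⟨ ≤-pred lt ⟩
  2 * k                   <⟨ *-monoʳ-< 2 k<n ⟩
  2 * n                   ∎)
  where open ≤-Reasoning

Within-short-layer : length xs ≡ n → length ys ≡ n → k < n → Within (2 * k) (s , xs) (t , ys) →
                     t ≡ s × drop k xs ≡ drop k ys
Within-short-layer {k = k} lx ly k<n (via-ancestor p q zs refl refl le) =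
  refl , drop-++-aligned k p q zs p≡q (*-cancelˡ-≤ 2 (subst (_≤ 2 * k) p+p≡2p le))
  where
  p≡q : length p ≡ length q
  p≡q = length-cancelʳ p q zs (trans lx (sym ly))
  p+p≡2p : length p + length q ≡ 2 * length p
  p+p≡2p = trans (cong (length p +_) (sym p≡q)) (n+n≡2*n (length p))
Within-short-layer {xs = xs} {ys = ys} lx ly k<n (via-basin lt) =
  contradiction (m<n⇒m<1+n lt) (layer-basin-too-far xs ys lx ly k<n)

_◅◅_ : {x y z : Vertex m} → Walk j x y → Walk k y z → Walk (j + k) x z
here _   ◅◅ w′ = w′
step a w ◅◅ w′ = step a (w ◅◅ w′)

Walk-cast : {x y : Vertex m} → j ≡ k → Walk j x y → Walk k x y
Walk-cast refl w = w

ascend : ∀ s (p zs : List (Fin m)) → Walk (length p) (s , p ++ zs) (s , zs)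
ascend s []      zs = here _
ascend s (i ∷ p) zs = step (up s i (p ++ zs)) (ascend s p zs)

descend : ∀ s (q zs : List (Fin m)) → Walk (length q) (s , zs) (s , q ++ zs)
descend s []      zs = here _
descend s (i ∷ q) zs =
  Walk-cast (+-comm (length q) 1) (descend s q zs ◅◅ step (down s i (q ++ zs)) (here _))

walk-via-ancestor : ∀ s (p q zs : List (Fin m)) → Walk (length p + length q) (s , p ++ zs) (s , q ++ zs)
walk-via-ancestor s p q zs = ascend s p zs ◅◅ descend s q zs

ascend-to-root : ∀ s (xs : List (Fin m)) → Walk (length xs) (s , xs) (s , [])
ascend-to-root s xs = subst (λ zs → Walk (length xs) (s , zs) (s , [])) (++-identityʳ xs) (ascend s xs [])

descend-from-root : ∀ s (ys : List (Fin m)) → Walk (length ys) (s , []) (s , ys)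
descend-from-root s ys = subst (λ zs → Walk (length ys) (s , []) (s , zs)) (++-identityʳ ys) (descend s ys [])

padded-walk : Fin m → ∀ e s (xs ys : List (Fin m)) →
              Walk (e + (length xs + length ys)) (s , xs) (not^ e s , ys)
padded-walk i zero          s xs ys = ascend-to-root s xs ◅◅ descend-from-root s ys
padded-walk i (suc zero)    s xs ys =
  Walk-cast (+-suc (length xs) (length ys))
    (ascend-to-root s xs ◅◅ step (across s) (descend-from-root (not s) ys))
padded-walk i (suc (suc e)) s xs ys =
  subst (λ b → Walk _ _ (b , ys)) (sym (not-involutive _))
    (step (down s i xs) (step (up s i xs) (padded-walk i e s xs ys)))

long-walk : {xs ys : List (Fin m)} → Fin m → length xs + length ys ≡ 2 * j → 2 * j ≤ d →
            Walk d (s , xs) (not^ d s , ys)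
long-walk {j = j} {d = d} {s = s} {xs = xs} {ys = ys} i L≡ le =
  subst₂ (λ l b → Walk l (s , xs) (b , ys)) length≡ side≡ (padded-walk i e s xs ys)
  where
  open ≡-Reasoning
  e = d ∸ 2 * j
  length≡ : e + (length xs + length ys) ≡ d
  length≡ = trans (cong (e +_) L≡) (m∸n+n≡m le)
  side≡ : not^ e s ≡ not^ d s
  side≡ = begin
    not^ e s                ≡⟨ cong (not^ e) (not^-even j s) ⟨
    not^ e (not^ (2 * j) s) ≡⟨ not^-+ e (2 * j) s ⟨
    not^ (e + 2 * j) s      ≡⟨ cong (λ l → not^ l s) (m∸n+n≡m le) ⟩
    not^ d s                ∎

Descendant : ℕ → Vertex m → Vertex m → Set
Descendant k (t , zs) x = ∃ λ q → length q ≡ k × x ≡ (t , q ++ zs)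

odd-walk-leaves-layer : length xs ≡ n → k < n → ℛ n (t , ys) → ¬ Walk (suc (2 * k)) (s , xs) (t , ys)
odd-walk-leaves-layer {xs = xs} {n = n} {k = k} {ys = ys} {s = s} lx k<n r w with Walk⇒Within w
... | via-ancestor _ _ _ _ _ _ =
  not-¬ (sym (not^-even k s)) (Walk⇒side w (trans lx (sym (ℛ⇒length≡ n r))))
... | via-basin lt = layer-basin-too-far xs ys lx (ℛ⇒length≡ n r) k<n lt

short-even-reach : length xs ≡ n → k < n → (x : Vertex m) →
                   (ℛ n x × Walk (2 * k) (s , xs) x) ⇔ Descendant k (s , drop k xs) x
short-even-reach {xs = xs} {n = n} {k = k} {s = s} lx k<n x@(_ , ys) = mk⇔ to from
  where
  to : ℛ n x × Walk (2 * k) (s , xs) x → Descendant k (s , drop k xs) x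
  to (r , w) with Within-short-layer lx (ℛ⇒length≡ n r) k<n (Walk⇒Within w)
  ... | refl , dk =
    take k ys , trans (length-take k ys) (m≤n⇒m⊓n≡m (subst (k ≤_) (sym (ℛ⇒length≡ n r)) (<⇒≤ k<n))) ,
    cong (s ,_) (sym (trans (cong (take k ys ++_) dk) (take++drop≡id k ys)))
  from : Descendant k (s , drop k xs) x → ℛ n x × Walk (2 * k) (s , xs) x
  from (q , refl , refl) = length≡⇒ℛ n s _ length≡ , Walk-cast length≡2k walk
    where
    length≡ : length (q ++ drop k xs) ≡ n
    length≡ = trans (length-++ q) (trans (cong (length q +_) (trans (length-drop k xs) (cong (_∸ k) lx)))
                                         (m+[n∸m]≡n (<⇒≤ k<n)))
    take-length : length (take k xs) ≡ length q
    take-length = trans (length-take k xs) (m≤n⇒m⊓n≡m (subst (length q ≤_) (sym lx) (<⇒≤ k<n)))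
    length≡2k : length (take k xs) + length q ≡ 2 * length q
    length≡2k = trans (cong (_+ length q) take-length) (n+n≡2*n (length q))
    walk : Walk (length (take k xs) + length q) (s , xs) (s , q ++ drop k xs)
    walk = subst (λ as → Walk (length (take k xs) + length q) (s , as) (s , q ++ drop k xs))
                 (take++drop≡id k xs) (walk-via-ancestor s (take k xs) q (drop k xs))

long-reach : Fin m → length xs ≡ n → 2 * n ≤ d → (x : Vertex m) →
             (ℛ n x × Walk d (s , xs) x) ⇔ Descendant n (not^ d s , []) x
long-reach {xs = xs} {n = n} {d = d} {s = s} i lx le x@(_ , ys) = mk⇔ to from
  where
  to : ℛ n x × Walk d (s , xs) x → Descendant n (not^ d s , []) x
  to (r , w) =
    ys , ℛ⇒length≡ n r , cong₂ _,_ (Walk⇒side w (trans lx (sym (ℛ⇒length≡ n r)))) (sym (++-identityʳ ys))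
  from : Descendant n (not^ d s , []) x → ℛ n x × Walk d (s , xs) x
  from (q , lq , refl) = length≡⇒ℛ n (not^ d s) (q ++ []) length≡ , long-walk {j = n} i L≡ le
    where
    length≡ : length (q ++ []) ≡ n
    length≡ = trans (cong length (++-identityʳ q)) lq
    L≡ : length xs + length (q ++ []) ≡ 2 * n
    L≡ = trans (cong₂ _+_ lx length≡) (n+n≡2*n n)

length-cartesianProductWith : ∀ {A B C : Set} (f : A → B → C) xs ys →
                              length (cartesianProductWith f xs ys) ≡ length xs * length ys
length-cartesianProductWith f []       ys = refl
length-cartesianProductWith f (x ∷ xs) ys =
  trans (length-++ (map (f x) ys)) (cong₂ _+_ (length-map (f x) ys) (length-cartesianProductWith f xs ys))

words : ∀ m → ℕ → List (List (Fin m))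
words m zero    = [ [] ]
words m (suc k) = cartesianProductWith _∷_ (allFin m) (words m k)

length-words : ∀ k → length (words m k) ≡ m ^ k
length-words zero    = refl
length-words {m} (suc k) =
  trans (length-cartesianProductWith _∷_ (allFin m) (words m k))
        (cong₂ _*_ (length-tabulate (id {A = Fin m})) (length-words k))

words-unique : ∀ k → Unique (words m k)
words-unique zero        = [] ∷ []
words-unique {m} (suc k) = cartesianProductWith⁺ _∷_ ∷-injective (allFin⁺ m) (words-unique k)

∈-words⁺ : (ys : List (Fin m)) → ys ∈ words m (length ys)
∈-words⁺ []       = here refl
∈-words⁺ (y ∷ ys) = ∈-cartesianProductWith⁺ _∷_ (∈-allFin y) (∈-words⁺ ys)

∈-words⁻ : ∀ k → ys ∈ words m k → length ys ≡ k
∈-words⁻ zero    (here refl) = refl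
∈-words⁻ {m = m} (suc k) ys∈ with ∈-cartesianProductWith⁻ _∷_ (allFin m) (words m k) ys∈
... | _ , _ , _ , ys′∈ , refl = cong suc (∈-words⁻ k ys′∈)

HasSize-⇔ : {S T : Vertex m → Set} {N : ℕ} → (∀ x → S x ⇔ T x) → HasSize T N → HasSize S N
HasSize-⇔ S⇔T (xs , unique , length≡ , ∈⇔T) = xs , unique , length≡ , λ x → ⇔-sym (S⇔T x) ⇔-∘ ∈⇔T x

HasSize-∅ : {S : Vertex m → Set} → (∀ x → ¬ S x) → HasSize S 0
HasSize-∅ ¬S = [] , [] , refl , λ x → mk⇔ (λ ()) (λ sx → contradiction sx (¬S x))

Descendant-size : ∀ k (a : Vertex m) → HasSize (Descendant k a) (m ^ k)
Descendant-size {m} k (t , zs) =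
  map graft (words m k) , map⁺ graft-injective (words-unique k) ,
  trans (length-map graft (words m k)) (length-words k) , λ x → mk⇔ to from
  where
  graft : List (Fin m) → Vertex m
  graft q = (t , q ++ zs)
  graft-injective : ∀ {q q′} → graft q ≡ graft q′ → q ≡ q′
  graft-injective e = ++-cancelʳ zs _ _ (cong proj₂ e)
  to : ∀ {x} → x ∈ map graft (words m k) → Descendant k (t , zs) x
  to x∈ with ∈-map⁻ graft x∈
  ... | q , q∈ , refl = q , ∈-words⁻ k q∈ , refl
  from : ∀ {x} → Descendant k (t , zs) x → x ∈ map graft (words m k)
  from (q , refl , refl) = ∈-map⁺ graft (∈-words⁺ q)

proposition3p8 : (m : ℕ) → 2 ≤ m → (v : Vertex m) → ¬ 𝒫 v → (h : ℕ) → ℛ h v →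
    ((k : ℕ) → k < h → rIs (suc (2 * k)) h v 0)
    × ((k : ℕ) → k < h → rIs (2 * k) h v (m ^ k))
    × ((d : ℕ) → 2 * h ≤ d → rIs d h v (m ^ h))
proposition3p8 _ (s≤s _) (s , xs) _ h r =
    (λ k k<h → HasSize-∅ λ { (t , ys) (r′ , w) → odd-walk-leaves-layer lx k<h r′ w })
  , (λ k k<h → HasSize-⇔ (short-even-reach lx k<h) (Descendant-size k (s , drop k xs)))
  , (λ d le → HasSize-⇔ (long-reach Fin.zero lx le) (Descendant-size h (not^ d s , [])))
  where
  lx = ℛ⇒length≡ h r
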